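{- Let a binary cubic code of length $3\ell$ mean a binary linear code $\mathcal{C}\subseteq\mathbb{F}_2^{3\ell}$ such that whenever $(u\,|\,v\,|\,w)\in\mathcal{C}$ with $u,v,w\in\mathbb{F}_2^{\ell}$, also $(w\,|\,u\,|\,v)\in\mathcal{C}$. There is no binary cubic self-dual $[60,30,12]$ code with weight enumerator $1+3451y^{12}+24128y^{14}+336081y^{16}+\cdots$.
   Context: A binary linear $[n,k,d]$ code is a $k$-dimensional subspace of $\mathbb{F}_2^n$ with minimum Hamming distance $d$; it is self-dual if it equals its dual with respect to the standard inner product on $\mathbb{F}_2^n$. The weight enumerator of $\mathcal{C}$ is $\sum_i A_i y^i$, where $A_i$ is the number of codewords of Hamming weight $i$. -}

module Defs where

open import Data.Bool using (Bool; true; false; _∧_; _xor_; if_then_else_)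
open import Data.Nat using (ℕ; zero; suc; _+_; _*_; _^_; _≤_)
open import Data.Nat.Properties using (_≟_)
open import Data.Vec using (Vec; []; _∷_; _++_; splitAt; replicate; zipWith; foldr)
open import Data.List using (List; length; filter; map; concatMap) renaming ([] to []ˡ; _∷_ to _∷ˡ_)
open import Data.Product using (Σ; _×_; _,_; ∃)
open import Relation.Binary.PropositionalEquality using (_≡_; _≢_)
open import Relation.Nullary using (Dec; yes; no)
open import Relation.Nullary.Decidable using (⌊_⌋)
open import Function.Bundles using (_⇔_)

-- Words of F₂ⁿ are Boolean vectors (true = 1); addition is xor.
Word : ℕ → Set
Word n = Vec Bool n

zeroWord : (n : ℕ) → Word n
zeroWord n = replicate n false

_⊕_ : {n : ℕ} → Word n → Word n → Word n
x ⊕ y = zipWith _xor_ x y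

dot : {n : ℕ} → Word n → Word n → Bool
dot x y = foldr _ _xor_ false (zipWith _∧_ x y)

wt : {n : ℕ} → Word n → ℕ
wt [] = 0
wt (true ∷ x) = suc (wt x)
wt (false ∷ x) = wt x

Code : ℕ → Set
Code n = Word n → Bool

_∈C_ : {n : ℕ} → Word n → Code n → Set
x ∈C C = C x ≡ true

IsLinear : {n : ℕ} → Code n → Set
IsLinear {n} C = (zeroWord n ∈C C) × (∀ x y → x ∈C C → y ∈C C → (x ⊕ y) ∈C C)

IsSelfDual : {n : ℕ} → Code n → Set
IsSelfDual C = ∀ x → (x ∈C C) ⇔ (∀ y → y ∈C C → dot x y ≡ false)

allWords : (n : ℕ) → List (Word n)
allWords zero = [] ∷ˡ []ˡ
allWords (suc n) = concatMap (λ w → (false ∷ w) ∷ˡ ((true ∷ w) ∷ˡ []ˡ)) (allWords n)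

size : {n : ℕ} → Code n → ℕ
size {n} C = length (filter (λ x → C x Data.Bool.≟ true) (allWords n))

-- A_i: number of codewords of weight i (coefficient of y^i in the weight enumerator)
A : {n : ℕ} → Code n → ℕ → ℕ
A {n} C i = length (filter (λ x → (C x ∧ ⌊ wt x ≟ i ⌋) Data.Bool.≟ true) (allWords n))

HasDimension : {n : ℕ} → Code n → ℕ → Set
HasDimension C k = size C ≡ 2 ^ k

-- minimum distance d (for a linear code: minimum weight of a nonzero codeword)
HasMinDistance : {n : ℕ} → Code n → ℕ → Set
HasMinDistance {n} C d =
  (∀ x → x ∈C C → x ≢ zeroWord n → d ≤ wt x) ×
  Σ (Word n) (λ x → x ∈C C × x ≢ zeroWord n × wt x ≡ d)

shift3 : (ℓ : ℕ) → Word (ℓ + (ℓ + ℓ)) → Word (ℓ + (ℓ + ℓ))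
shift3 ℓ x with splitAt ℓ x
... | u , vw , _ with splitAt ℓ vw
... | v , w , _ = w ++ (u ++ v)

IsCubic : (ℓ : ℕ) → Code (ℓ + (ℓ + ℓ)) → Set
IsCubic ℓ C = ∀ x → x ∈C C → shift3 ℓ x ∈C C

{-# OPTIONS --safe #-}
-- The block shift σ (u|v|w) ↦ (w|u|v) has order 3 and preserves membership in a cubic code
-- and Hamming weight, so it permutes the codewords of weight i. A word fixed by σ is (u|u|u),
-- of weight 3·wt u; so for 3 ∤ i every orbit has exactly three elements and 3 ∣ A_i.
-- But A_14 = 24128 ≡ 2 (mod 3).
module Submission where

open import Defs
open import Data.Bool using (Bool; true; false; _∧_)
open import Data.Bool.Properties using (T-≡) renaming (_≟_ to _≟ᵇ_)
open import Data.Empty using (⊥; ⊥-elim)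
open import Data.List using (List; []; _∷_; length; filter; concatMap)
open import Data.List.Membership.Propositional using (_∈_)
open import Data.List.Membership.Propositional.Properties using (∈-filter⁺; ∈-filter⁻)
open import Data.List.Properties using (filter-all; filter-reject)
open import Data.List.Relation.Unary.All as All using (All; []; _∷_)
open import Data.List.Relation.Unary.AllPairs using ([]; _∷_)
open import Data.List.Relation.Unary.Any using (here; there)
open import Data.List.Relation.Unary.Unique.Propositional using (Unique)
import Data.List.Relation.Unary.Unique.Propositional.Properties as Unique
open import Data.Nat using (ℕ; zero; suc; _+_; _*_; _<_; z<s)
open import Data.Nat.Divisibility using (_∣_; m∣m*n; _∣?_; ∣m∣n⇒∣m+n; ∣-refl; _∣0)
open import Data.Nat.Induction using (<-wellFounded)
open import Data.Nat.Properties using (+-comm; +-assoc; +-identityʳ; m<n+m; _≟_)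
open import Data.Product using (Σ; _×_; _,_; proj₁; proj₂)
open import Data.Vec using (Vec; []; _∷_; _++_; splitAt; tail)
open import Data.Vec.Properties using (++-injectiveˡ; ++-injectiveʳ; ≡-dec)
open import Function.Base using (_∘_)
open import Function.Bundles using (Equivalence)
open import Induction.WellFounded using (Acc; acc)
open import Relation.Binary.Definitions using (DecidableEquality)
open import Relation.Binary.PropositionalEquality
  using (_≡_; _≢_; refl; sym; trans; cong; subst; module ≡-Reasoning)
open import Relation.Nullary using (¬_; ¬?; yes; no)
open import Relation.Nullary.Decidable using (⌊_⌋; toWitness; from-no)
open import Relation.Unary using (Pred; Decidable)

module Removal {A : Set} (_≟ᴬ_ : DecidableEquality A) where

  remove : A → List A → List A
  remove x = filter (λ y → ¬? (y ≟ᴬ x))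

  length-remove : ∀ {x xs} → Unique xs → x ∈ xs → length xs ≡ suc (length (remove x xs))
  length-remove {x} {_ ∷ ys} (x∉ys ∷ _) (here refl) = cong suc (cong length (sym removes-head))
    where
    removes-head : remove x (x ∷ ys) ≡ ys
    removes-head = trans (filter-reject (λ y → ¬? (y ≟ᴬ x)) (λ x≢x → x≢x refl))
                         (filter-all (λ y → ¬? (y ≟ᴬ x)) (All.map (λ x≢y y≡x → x≢y (sym y≡x)) x∉ys))
  length-remove {x} {y ∷ _} (y∉ys ∷ ys-unique) (there x∈ys) with y ≟ᴬ x
  ... | yes refl = ⊥-elim (All.lookup y∉ys x∈ys refl)
  ... | no _     = cong suc (length-remove ys-unique x∈ys)

  ∈-remove⁺ : ∀ {x y xs} → y ∈ xs → y ≢ x → y ∈ remove x xs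
  ∈-remove⁺ = ∈-filter⁺ (λ y → ¬? (y ≟ᴬ _))

  ∈-remove⁻ : ∀ {x y xs} → y ∈ remove x xs → y ∈ xs × y ≢ x
  ∈-remove⁻ = ∈-filter⁻ (λ y → ¬? (y ≟ᴬ _))

  remove-unique : ∀ {x xs} → Unique xs → Unique (remove x xs)
  remove-unique = Unique.filter⁺ (λ y → ¬? (y ≟ᴬ _))

module OrderThree {A : Set} (_≟ᴬ_ : DecidableEquality A)
                  (σ : A → A) (σ³≡id : ∀ x → σ (σ (σ x)) ≡ x) where

  open Removal _≟ᴬ_

  σ-injective : ∀ {x y} → σ x ≡ σ y → x ≡ y
  σ-injective {x} {y} σx≡σy = trans (sym (σ³≡id x)) (trans (cong (λ z → σ (σ z)) σx≡σy) (σ³≡id y))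

  Closed : Pred (List A) _
  Closed xs = ∀ {y} → y ∈ xs → σ y ∈ xs

  FixedPointFree : Pred (List A) _
  FixedPointFree xs = ∀ {y} → y ∈ xs → σ y ≢ y

  removeOrbit : A → List A → List A
  removeOrbit x xs = remove (σ (σ x)) (remove (σ x) (remove x xs))

  ∈-removeOrbit⁻ : ∀ {x y xs} → y ∈ removeOrbit x xs →
                   y ∈ xs × y ≢ x × y ≢ σ x × y ≢ σ (σ x)
  ∈-removeOrbit⁻ y∈ with ∈-remove⁻ y∈
  ... | y∈₂ , y≢σσx with ∈-remove⁻ y∈₂
  ... | y∈₁ , y≢σx with ∈-remove⁻ y∈₁
  ... | y∈xs , y≢x = y∈xs , y≢x , y≢σx , y≢σσx

  module _ {x xs} (unique : Unique xs) (closed : Closed xs) (free : FixedPointFree xs)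
           (x∈xs : x ∈ xs) where

    length-removeOrbit : length xs ≡ 3 + length (removeOrbit x xs)
    length-removeOrbit =
      trans (length-remove unique x∈xs)
        (cong suc (trans (length-remove (remove-unique unique) σx∈₁)
          (cong suc (length-remove (remove-unique (remove-unique unique)) σσx∈₂))))
      where
      σx∈xs = closed x∈xs
      σσx≢x : σ (σ x) ≢ x
      σσx≢x σσx≡x = free x∈xs (sym (trans (sym (σ³≡id x)) (cong σ σσx≡x)))
      σx∈₁ = ∈-remove⁺ σx∈xs (free x∈xs)
      σσx∈₂ = ∈-remove⁺ (∈-remove⁺ (closed σx∈xs) σσx≢x) (free σx∈xs)

    removeOrbit-closed : Closed (removeOrbit x xs)
    removeOrbit-closed {y} y∈ with ∈-removeOrbit⁻ y∈
    ... | y∈xs , y≢x , y≢σx , y≢σσx =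
      ∈-remove⁺ (∈-remove⁺ (∈-remove⁺ (closed y∈xs)
        (λ σy≡x → y≢σσx (trans (sym (σ³≡id y)) (cong (λ z → σ (σ z)) σy≡x))))
        (λ σy≡σx → y≢x (σ-injective σy≡σx)))
        (λ σy≡σσx → y≢σx (σ-injective σy≡σσx))

  3∣length : ∀ {xs} → Unique xs → Closed xs → FixedPointFree xs → 3 ∣ length xs
  3∣length {xs} = go xs (<-wellFounded (length xs))
    where
    go : ∀ xs → Acc _<_ (length xs) → Unique xs → Closed xs → FixedPointFree xs → 3 ∣ length xs
    go []           _         _      _      _    = 3 ∣0
    go xs@(x ∷ _) (acc rec) unique closed free =
      subst (3 ∣_) (sym length≡) (∣m∣n⇒∣m+n ∣-refl
        (go rest (rec shorter) (remove-unique (remove-unique (remove-unique unique)))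
            (removeOrbit-closed unique closed free (here refl))
            (λ y∈ → free (proj₁ (∈-removeOrbit⁻ y∈)))))
      where
      rest = removeOrbit x xs
      length≡ = length-removeOrbit unique closed free (here refl)
      shorter : length rest < length xs
      shorter = subst (length rest <_) (sym length≡) (m<n+m (length rest) z<s)

splitAt-++ : ∀ {A : Set} m {n} (u : Vec A m) (v : Vec A n) → splitAt m (u ++ v) ≡ (u , v , refl)
splitAt-++ zero    []      v = refl
splitAt-++ (suc m) (a ∷ u) v rewrite splitAt-++ m u v = refl

wt-++ : ∀ {m n} (u : Word m) (v : Word n) → wt (u ++ v) ≡ wt u + wt v
wt-++ []          v = refl
wt-++ (true ∷ u)  v = cong suc (wt-++ u v)
wt-++ (false ∷ u) v = wt-++ u v

module _ (ℓ : ℕ) where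

  blocks : (x : Word (ℓ + (ℓ + ℓ))) →
           Σ (Word ℓ) λ u → Σ (Word ℓ) λ v → Σ (Word ℓ) λ w → x ≡ u ++ (v ++ w)
  blocks x with splitAt ℓ x
  ... | u , vw , x≡u++vw with splitAt ℓ vw
  ... | v , w , vw≡v++w = u , v , w , trans x≡u++vw (cong (u ++_) vw≡v++w)

  shift3-++ : ∀ (u v w : Word ℓ) → shift3 ℓ (u ++ (v ++ w)) ≡ w ++ (u ++ v)
  shift3-++ u v w rewrite splitAt-++ ℓ u (v ++ w) | splitAt-++ ℓ v w = refl

  shift3³≡id : ∀ x → shift3 ℓ (shift3 ℓ (shift3 ℓ x)) ≡ x
  shift3³≡id x with blocks x
  ... | u , v , w , refl rewrite shift3-++ u v w | shift3-++ w u v | shift3-++ v w u = refl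

  wt-shift3 : ∀ x → wt (shift3 ℓ x) ≡ wt x
  wt-shift3 x with blocks x
  ... | u , v , w , refl rewrite shift3-++ u v w | wt-++ w (u ++ v) | wt-++ u v
                               | wt-++ u (v ++ w) | wt-++ v w =
    trans (+-comm (wt w) (wt u + wt v)) (+-assoc (wt u) (wt v) (wt w))

  shift3-fixed⇒3∣wt : ∀ x → shift3 ℓ x ≡ x → 3 ∣ wt x
  shift3-fixed⇒3∣wt x fixed with blocks x
  ... | u , v , w , refl rewrite shift3-++ u v w =
    triple (++-injectiveˡ u v (++-injectiveʳ w u fixed)) (++-injectiveˡ w u fixed)
    where
    triple : u ≡ v → w ≡ u → 3 ∣ wt (u ++ (v ++ w))
    triple refl refl = subst (3 ∣_) (sym wt-uuu) (m∣m*n (wt u))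
      where
      open ≡-Reasoning
      wt-uuu : wt (u ++ (u ++ u)) ≡ 3 * wt u
      wt-uuu = begin
        wt (u ++ (u ++ u))          ≡⟨ wt-++ u (u ++ u) ⟩
        wt u + wt (u ++ u)          ≡⟨ cong (wt u +_) (wt-++ u u) ⟩
        wt u + (wt u + wt u)        ≡⟨ cong (λ t → wt u + (wt u + t)) (sym (+-identityʳ (wt u))) ⟩
        3 * wt u                    ∎

extend : ∀ {n} → Word n → List (Word (suc n))
extend w = (false ∷ w) ∷ (true ∷ w) ∷ []

∈-concatMap-extend : ∀ {n} b {w : Word n} {ws} → w ∈ ws → (b ∷ w) ∈ concatMap extend ws
∈-concatMap-extend false (here refl) = here refl
∈-concatMap-extend true  (here refl) = there (here refl)
∈-concatMap-extend b     (there w∈)  = there (there (∈-concatMap-extend b w∈))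

∈-allWords : ∀ {n} (x : Word n) → x ∈ allWords n
∈-allWords []      = here refl
∈-allWords (b ∷ x) = ∈-concatMap-extend b (∈-allWords x)

tail-concatMap-extend : ∀ {n} {P : Word n → Set} {ws} → All P ws →
                        All (λ y → P (tail y)) (concatMap extend ws)
tail-concatMap-extend []       = []
tail-concatMap-extend (p ∷ ps) = p ∷ p ∷ tail-concatMap-extend ps

concatMap-extend-unique : ∀ {n} {ws : List (Word n)} → Unique ws → Unique (concatMap extend ws)
concatMap-extend-unique [] = []
concatMap-extend-unique {ws = w ∷ ws} (w∉ws ∷ ws-unique) =
  ((λ ()) ∷ distinct-tails) ∷ distinct-tails ∷ concatMap-extend-unique ws-unique
  where
  distinct-tails : ∀ {b} → All (b ∷ w ≢_) (concatMap extend ws)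
  distinct-tails = All.map (λ w≢y w∷≡y → w≢y (cong tail w∷≡y)) (tail-concatMap-extend w∉ws)

allWords-unique : ∀ n → Unique (allWords n)
allWords-unique zero    = [] ∷ []
allWords-unique (suc n) = concatMap-extend-unique (allWords-unique n)

3∣count-shift3-invariant : ∀ ℓ {P : Word (ℓ + (ℓ + ℓ)) → Set} (P? : Decidable P) →
  (∀ {x} → P x → P (shift3 ℓ x)) → (∀ {x} → P x → shift3 ℓ x ≢ x) →
  3 ∣ length (filter P? (allWords (ℓ + (ℓ + ℓ))))
3∣count-shift3-invariant ℓ {P} P? invariant free =
  3∣length (Unique.filter⁺ P? (allWords-unique _))
    (λ {y} y∈ → ∈-filter⁺ P? (∈-allWords (shift3 ℓ y)) (invariant (satisfies y∈)))
    (λ y∈ → free (satisfies y∈))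
  where
  open OrderThree (≡-dec _≟ᵇ_) (shift3 ℓ) (shift3³≡id ℓ)
  satisfies : ∀ {y} → y ∈ filter P? (allWords _) → P y
  satisfies = proj₂ ∘ ∈-filter⁻ P? {xs = allWords _}

∧-≡true : ∀ {a b} → a ∧ b ≡ true → a ≡ true × b ≡ true
∧-≡true {true} {true} refl = refl , refl

3∣A-of-cubic : ∀ ℓ (C : Code (ℓ + (ℓ + ℓ))) {i} → IsCubic ℓ C → ¬ 3 ∣ i → 3 ∣ A C i
3∣A-of-cubic ℓ C {i} cubic 3∤i =
  3∣count-shift3-invariant ℓ (λ x → HasWeight x ≟ᵇ true) invariant free
  where
  HasWeight : Word (ℓ + (ℓ + ℓ)) → Bool
  HasWeight x = C x ∧ ⌊ wt x ≟ i ⌋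

  invariant : ∀ {x} → HasWeight x ≡ true → HasWeight (shift3 ℓ x) ≡ true
  invariant {x} h rewrite wt-shift3 ℓ x | cubic x (proj₁ (∧-≡true {C x} h)) = proj₂ (∧-≡true {C x} h)

  free : ∀ {x} → HasWeight x ≡ true → shift3 ℓ x ≢ x
  free {x} h fixed = 3∤i (subst (3 ∣_) wt≡i (shift3-fixed⇒3∣wt ℓ x fixed))
    where
    wt≡i : wt x ≡ i
    wt≡i = toWitness (Equivalence.from T-≡ (proj₂ (∧-≡true {C x} h)))

mainTheorem4 : (C : Code (20 + (20 + 20))) →
    IsLinear C → IsCubic 20 C → IsSelfDual C →
    HasDimension C 30 → HasMinDistance C 12 →
    A C 0 ≡ 1 → A C 12 ≡ 3451 → A C 13 ≡ 0 → A C 14 ≡ 24128 →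
    A C 15 ≡ 0 → A C 16 ≡ 336081 → ⊥
-- Only cubicity and the value of A₁₄ are needed.
mainTheorem4 C _ cubic _ _ _ _ _ _ A₁₄≡24128 _ _ =
  from-no (3 ∣? 24128) (subst (3 ∣_) A₁₄≡24128 (3∣A-of-cubic 20 C cubic (from-no (3 ∣? 14))))
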